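{- Let $P$ be a closed and guarded synchronization-free ITMPC process term (every parallel composition in it has empty synchronization set). Then $\Gamma_{\mathrm e}[\![P]\!]$ cannot perform any action transition, and $\mathit{rate}_{\mathrm{it,t}}(P)=\mathit{rate}_{\mathrm{ot,t}}(\Gamma_{\mathrm e}[\![P]\!])$.
   Context: Let $\mathit{Name}=\mathit{Name}_{\mathrm v}\cup\{\tau\}$ ($\tau$ internal, $\mathit{Name}_{\mathrm v}$ visible names); relabelings $\varphi:\mathit{Name}\to\mathit{Name}$ satisfy $\varphi^{ -1}(\tau)=\{\tau\}$; $\mathit{Var}$ is a set of process variables. ITMPC terms: $P ::= \underline{0} \mid \langle a,\lambda\rangle . P \mid P+P \mid P \parallel_S P \mid P/H \mid P[\varphi] \mid X \mid \mathrm{rec}\,X:P$ ($a\in\mathit{Name}$, $\lambda>0$, $S,H\subseteq\mathit{Name}_{\mathrm v}$). Transitions $P\xrightarrow{a,\lambda}P'$ form a multiset (multiplicity = number of derivations) generated by: $\langle a,\lambda\rangle.P\xrightarrow{a,\lambda}P$; either summand of $+$ may move; interleaving of $\parallel_S$ operands for $a\notin S$ and synchronization for $a\in S$ with rate $\lambda_1\otimes\lambda_2$ ($\otimes$ a fixed associative commutative operation on $\mathbb{R}_{>0}$); $P/H$ turns names in $H$ into $\tau$; $P[\varphi]$ relabels $a$ to $\varphi(a)$; $\mathrm{rec}\,X:P$ moves as its unfolding $P\{\mathrm{rec}\,X:P\hookrightarrow X\}$. $\mathit{rate}_{\mathrm{it,t}}(P)=\sum\{\!|\lambda\mid \exists a,P'.\,P\xrightarrow{a,\lambda}P'|\!\}$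 (multiset sum). OTMPC terms: $Q ::= \underline{0} \mid a.Q \mid (\lambda).Q \mid Q+Q \mid Q\parallel_S Q \mid Q/H \mid Q[\varphi] \mid X \mid \mathrm{rec}\,X:Q$. Action transitions $Q\xrightarrow{a}Q'$ (a set) arise from $a.Q\xrightarrow{a}Q$, with the standard rules for $+$, $\parallel_S$ (interleaving for $a\notin S$, synchronization for $a\in S$), hiding, relabeling, recursion; $(\lambda).Q$ has no action transitions. Time transitions $Q\xrightarrow{\lambda}_{\mathrm M}Q'$ (a multiset with derivation multiplicities) arise from $(\lambda).Q\xrightarrow{\lambda}_{\mathrm M}Q$ and are propagated by $+$ (either summand), $\parallel_S$ (either operand independently), hiding, relabeling and recursion unfolding. $\mathit{rate}_{\mathrm{ot,t}}(Q)=\sum\{\!|\lambda\mid\exists Q'.\,Q\xrightarrow{\lambda}_{\mathrm M}Q'|\!\}$. $\Gamma_{\mathrm e}$: $\Gamma_{\mathrm e}[\![\underline 0]\!]=\underline 0$; $\Gamma_{\mathrm e}[\![\langle a,\lambda\rangle.P]\!]=(\lambda).a.\Gamma_{\mathrm e}[\![P]\!]$; $\Gamma_{\mathrm e}[\![P_1+P_2]\!]=\Gamma_{\mathrm e}[\![P_1]\!]+\Gamma_{\mathrm e}[\![P_2]\!]$; $\Gamma_{\mathrm e}[\![P_1\parallel_\emptyset P_2]\!]=\Gamma_{\mathrm e}[\![P_1]\!]\parallel_\emptyset\Gamma_{\mathrm e}[\![P_2]\!]$; $\Gamma_{\mathrm e}[\![P/H]\!]=\Gamma_{\mathrm e}[\![P]\!]/H$;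 $\Gamma_{\mathrm e}[\![P[\varphi]]\!]=\Gamma_{\mathrm e}[\![P]\!][\varphi]$; $\Gamma_{\mathrm e}[\![X]\!]=X$; $\Gamma_{\mathrm e}[\![\mathrm{rec}\,X:P]\!]=\mathrm{rec}\,X:\Gamma_{\mathrm e}[\![P]\!]$. -}

module Defs where

open import Level using (0ℓ)
open import Data.Nat using (ℕ; zero; suc)
open import Data.Nat.Properties using (_≟_)
open import Data.Fin using (Fin; zero; suc)
open import Data.Bool using (Bool; true; false; if_then_else_)
open import Data.List using (List; []; _∷_)
open import Data.List.Membership.Propositional using (_∈_)
open import Data.Product using (Σ; _×_; _,_)
open import Relation.Nullary using (¬_; yes; no)
open import Relation.Binary.PropositionalEquality using (_≡_; _≢_)
open import Function.Bundles using (_↔_; Inverse)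
open import Algebra.Bundles using (CommutativeMonoid)
open import Algebra.Core using (Op₂)

Var : Set
Var = ℕ

-- The calculi are parametric in the set V of visible names (Name_v),
-- the domain of rates R (a commutative monoid; its _∙_ is rate summation,
-- its ε the empty sum), and the synchronisation operation _⊗_ on rates.
module Calculus (V : Set) (R : CommutativeMonoid 0ℓ 0ℓ)
                (_⊗_ : Op₂ (CommutativeMonoid.Carrier R)) where

  open CommutativeMonoid R renaming (Carrier to Rate; _∙_ to _⊕_; ε to 𝟘)

  data Name : Set where
    τ   : Name
    vis : V → Name

  NSet : Set
  NSet = V → Bool

  -- relabelings φ : Name → Name with φ⁻¹(τ) = {τ} correspond exactly to
  -- functions V → V (visible names go to visible names, τ to τ)
  Relab : Set
  Relab = V → V

  relab : Relab → Name → Name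
  relab φ τ       = τ
  relab φ (vis v) = vis (φ v)

  hideN : NSet → Name → Name
  hideN H τ       = τ
  hideN H (vis v) = if H v then τ else vis v

  data NotIn (S : NSet) : Name → Set where
    τ∉ : NotIn S τ
    v∉ : ∀ {v} → S v ≡ false → NotIn S (vis v)

  Empty : NSet → Set
  Empty S = ∀ v → S v ≡ false

  infixr 6 _+ᵢ_
  data ITerm : Set where
    nil  : ITerm
    pre  : Name → Rate → ITerm → ITerm
    _+ᵢ_ : ITerm → ITerm → ITerm
    par  : ITerm → NSet → ITerm → ITerm
    hide : ITerm → NSet → ITerm
    ren  : ITerm → Relab → ITerm
    var  : Var → ITerm
    rec  : Var → ITerm → ITerm

  substI : ITerm → Var → ITerm → ITerm
  substI N X nil          = nil
  substI N X (pre a l P)  = pre a l (substI N X P)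
  substI N X (P +ᵢ Q)     = substI N X P +ᵢ substI N X Q
  substI N X (par P S Q)  = par (substI N X P) S (substI N X Q)
  substI N X (hide P H)   = hide (substI N X P) H
  substI N X (ren P φ)    = ren (substI N X P) φ
  substI N X (var Y) with Y ≟ X
  ... | yes _ = N
  ... | no  _ = var Y
  substI N X (rec Y P) with Y ≟ X
  ... | yes _ = rec Y P
  ... | no  _ = rec Y (substI N X P)

  -- derivations of P --a,λ--> P'  (multiplicity = number of derivations)
  data ITStep : ITerm → Name → Rate → ITerm → Set where
    pre   : ∀ {a l P} → ITStep (pre a l P) a l P
    sumL  : ∀ {P Q a l P'} → ITStep P a l P' → ITStep (P +ᵢ Q) a l P'
    sumR  : ∀ {P Q a l Q'} → ITStep Q a l Q' → ITStep (P +ᵢ Q) a l Q'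
    parL  : ∀ {P S Q a l P'} → NotIn S a → ITStep P a l P' →
            ITStep (par P S Q) a l (par P' S Q)
    parR  : ∀ {P S Q a l Q'} → NotIn S a → ITStep Q a l Q' →
            ITStep (par P S Q) a l (par P S Q')
    sync  : ∀ {P S Q v l₁ l₂ P' Q'} → S v ≡ true →
            ITStep P (vis v) l₁ P' → ITStep Q (vis v) l₂ Q' →
            ITStep (par P S Q) (vis v) (l₁ ⊗ l₂) (par P' S Q')
    hid   : ∀ {P H a l P'} → ITStep P a l P' →
            ITStep (hide P H) (hideN H a) l (hide P' H)
    rel   : ∀ {P φ a l P'} → ITStep P a l P' →
            ITStep (ren P φ) (relab φ a) l (ren P' φ)
    unf   : ∀ {X P a l P'} → ITStep (substI (rec X P) X P) a l P' →
            ITStep (rec X P) a l P'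

  ITDer : ITerm → Set
  ITDer P = Σ Name λ a → Σ Rate λ l → Σ ITerm λ P' → ITStep P a l P'

  itRate : ∀ {P} → ITDer P → Rate
  itRate (a , l , _ , _) = l

  infixr 6 _+ₒ_
  data OTerm : Set where
    nil  : OTerm
    act  : Name → OTerm → OTerm
    del  : Rate → OTerm → OTerm
    _+ₒ_ : OTerm → OTerm → OTerm
    par  : OTerm → NSet → OTerm → OTerm
    hide : OTerm → NSet → OTerm
    ren  : OTerm → Relab → OTerm
    var  : Var → OTerm
    rec  : Var → OTerm → OTerm

  substO : OTerm → Var → OTerm → OTerm
  substO N X nil          = nil
  substO N X (act a Q)    = act a (substO N X Q)
  substO N X (del l Q)    = del l (substO N X Q)
  substO N X (P +ₒ Q)     = substO N X P +ₒ substO N X Q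
  substO N X (par P S Q)  = par (substO N X P) S (substO N X Q)
  substO N X (hide P H)   = hide (substO N X P) H
  substO N X (ren P φ)    = ren (substO N X P) φ
  substO N X (var Y) with Y ≟ X
  ... | yes _ = N
  ... | no  _ = var Y
  substO N X (rec Y P) with Y ≟ X
  ... | yes _ = rec Y P
  ... | no  _ = rec Y (substO N X P)

  data OTAct : OTerm → Name → OTerm → Set where
    act   : ∀ {a Q} → OTAct (act a Q) a Q
    sumL  : ∀ {P Q a P'} → OTAct P a P' → OTAct (P +ₒ Q) a P'
    sumR  : ∀ {P Q a Q'} → OTAct Q a Q' → OTAct (P +ₒ Q) a Q'
    parL  : ∀ {P S Q a P'} → NotIn S a → OTAct P a P' →
            OTAct (par P S Q) a (par P' S Q)
    parR  : ∀ {P S Q a Q'} → NotIn S a → OTAct Q a Q' →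
            OTAct (par P S Q) a (par P S Q')
    sync  : ∀ {P S Q v P' Q'} → S v ≡ true →
            OTAct P (vis v) P' → OTAct Q (vis v) Q' →
            OTAct (par P S Q) (vis v) (par P' S Q')
    hid   : ∀ {P H a P'} → OTAct P a P' →
            OTAct (hide P H) (hideN H a) (hide P' H)
    rel   : ∀ {P φ a P'} → OTAct P a P' →
            OTAct (ren P φ) (relab φ a) (ren P' φ)
    unf   : ∀ {X P a P'} → OTAct (substO (rec X P) X P) a P' →
            OTAct (rec X P) a P'

  -- time transitions Q --λ-->_M Q'  (multiplicity = number of derivations)
  data OTTime : OTerm → Rate → OTerm → Set where
    del   : ∀ {l Q} → OTTime (del l Q) l Q
    sumL  : ∀ {P Q l P'} → OTTime P l P' → OTTime (P +ₒ Q) l P'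
    sumR  : ∀ {P Q l Q'} → OTTime Q l Q' → OTTime (P +ₒ Q) l Q'
    parL  : ∀ {P S Q l P'} → OTTime P l P' → OTTime (par P S Q) l (par P' S Q)
    parR  : ∀ {P S Q l Q'} → OTTime Q l Q' → OTTime (par P S Q) l (par P S Q')
    hid   : ∀ {P H l P'} → OTTime P l P' → OTTime (hide P H) l (hide P' H)
    rel   : ∀ {P φ l P'} → OTTime P l P' → OTTime (ren P φ) l (ren P' φ)
    unf   : ∀ {X P l P'} → OTTime (substO (rec X P) X P) l P' →
            OTTime (rec X P) l P'

  OTDer : OTerm → Set
  OTDer Q = Σ Rate λ l → Σ OTerm λ Q' → OTTime Q l Q'

  otRate : ∀ {Q} → OTDer Q → Rate
  otRate (l , _ , _) = l

  sumFin : (n : ℕ) → (Fin n → Rate) → Rate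
  sumFin zero    f = 𝟘
  sumFin (suc n) f = f zero ⊕ sumFin n (λ i → f (suc i))

  -- rate_it,t(P) = r : the derivations of P are finitely many and their
  -- rates sum (as a multiset) to r
  RateIT : ITerm → Rate → Set
  RateIT P r = Σ ℕ λ n → Σ (Fin n ↔ ITDer P) λ e →
               r ≈ sumFin n (λ i → itRate (Inverse.to e i))

  RateOT : OTerm → Rate → Set
  RateOT Q r = Σ ℕ λ n → Σ (Fin n ↔ OTDer Q) λ e →
               r ≈ sumFin n (λ i → otRate (Inverse.to e i))

  data Scoped (Γ : List Var) : ITerm → Set where
    nil  : Scoped Γ nil
    pre  : ∀ {a l P} → Scoped Γ P → Scoped Γ (pre a l P)
    sum  : ∀ {P Q} → Scoped Γ P → Scoped Γ Q → Scoped Γ (P +ᵢ Q)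
    par  : ∀ {P S Q} → Scoped Γ P → Scoped Γ Q → Scoped Γ (par P S Q)
    hide : ∀ {P H} → Scoped Γ P → Scoped Γ (hide P H)
    ren  : ∀ {P φ} → Scoped Γ P → Scoped Γ (ren P φ)
    var  : ∀ {X} → X ∈ Γ → Scoped Γ (var X)
    rec  : ∀ {X P} → Scoped (X ∷ Γ) P → Scoped Γ (rec X P)

  Closed : ITerm → Set
  Closed P = Scoped [] P

  data GuardedIn (X : Var) : ITerm → Set where
    nil   : GuardedIn X nil
    pre   : ∀ {a l P} → GuardedIn X (pre a l P)
    sum   : ∀ {P Q} → GuardedIn X P → GuardedIn X Q → GuardedIn X (P +ᵢ Q)
    par   : ∀ {P S Q} → GuardedIn X P → GuardedIn X Q → GuardedIn X (par P S Q)
    hide  : ∀ {P H} → GuardedIn X P → GuardedIn X (hide P H)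
    ren   : ∀ {P φ} → GuardedIn X P → GuardedIn X (ren P φ)
    var   : ∀ {Y} → Y ≢ X → GuardedIn X (var Y)
    recEq : ∀ {P} → GuardedIn X (rec X P)
    recNe : ∀ {Y P} → Y ≢ X → GuardedIn X P → GuardedIn X (rec Y P)

  data Guarded : ITerm → Set where
    nil  : Guarded nil
    pre  : ∀ {a l P} → Guarded P → Guarded (pre a l P)
    sum  : ∀ {P Q} → Guarded P → Guarded Q → Guarded (P +ᵢ Q)
    par  : ∀ {P S Q} → Guarded P → Guarded Q → Guarded (par P S Q)
    hide : ∀ {P H} → Guarded P → Guarded (hide P H)
    ren  : ∀ {P φ} → Guarded P → Guarded (ren P φ)
    var  : ∀ {X} → Guarded (var X)
    rec  : ∀ {X P} → GuardedIn X P → Guarded P → Guarded (rec X P)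

  data SyncFree : ITerm → Set where
    nil  : SyncFree nil
    pre  : ∀ {a l P} → SyncFree P → SyncFree (pre a l P)
    sum  : ∀ {P Q} → SyncFree P → SyncFree Q → SyncFree (P +ᵢ Q)
    par  : ∀ {P S Q} → Empty S → SyncFree P → SyncFree Q → SyncFree (par P S Q)
    hide : ∀ {P H} → SyncFree P → SyncFree (hide P H)
    ren  : ∀ {P φ} → SyncFree P → SyncFree (ren P φ)
    var  : ∀ {X} → SyncFree (var X)
    rec  : ∀ {X P} → SyncFree P → SyncFree (rec X P)

  -- the encoding Γ_e (the paper defines it on synchronisation-free terms;
  -- on those it coincides with the total function below)
  Γe : ITerm → OTerm
  Γe nil         = nil
  Γe (pre a l P) = del l (act a (Γe P))
  Γe (P +ᵢ Q)    = Γe P +ₒ Γe Q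
  Γe (par P S Q) = par (Γe P) S (Γe Q)
  Γe (hide P H)  = hide (Γe P) H
  Γe (ren P φ)   = ren (Γe P) φ
  Γe (var X)     = var X
  Γe (rec X P)   = rec X (Γe P)

module Submission where

-- The encoding Γe turns every prefix ⟨a,λ⟩.P into (λ).a.Γe P, so every action of
-- Γe P sits behind a delay: Γe P has no action transitions, and its time
-- transitions correspond one-to-one, rate for rate, to the transitions of P.

open import Defs
open import Level using (0ℓ)
open import Data.Product using (Σ; _×_; _,_; proj₁; proj₂)
open import Relation.Nullary using (¬_; yes; no)
open import Algebra.Bundles using (CommutativeMonoid)
open import Algebra.Core using (Op₂)
open import Algebra.Structures using (IsCommutativeSemigroup)
open import Data.Nat using (ℕ; zero; suc; _+_; _<_; s≤s; s<s⁻¹)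
open import Data.Nat.Properties using (_≟_; ≤-trans; ≤-refl; m≤n+m; m+n≤o⇒m≤o)
open import Data.Fin using (Fin; zero; suc; splitAt)
open import Data.Fin.Properties using (+↔⊎)
open import Data.Sum using (_⊎_; inj₁; inj₂; [_,_]′)
open import Data.Sum.Function.Propositional using (_⊎-↔_)
open import Data.Empty using (⊥; ⊥-elim)
open import Data.Bool using (true)
open import Data.Bool.Properties using () renaming (_≟_ to _≟ᵇ_)
open import Axiom.UniquenessOfIdentityProofs using (module Decidable⇒UIP)
open import Data.List using (_∷_)
open import Data.List.Membership.Propositional using (_∉_)
open import Data.List.Relation.Unary.Any using (here; there)
open import Data.List.Relation.Binary.Subset.Propositional using (_⊆_)
open import Data.List.Relation.Binary.Subset.Propositional.Properties using (∷⁺ʳ)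
open import Relation.Binary.PropositionalEquality
  using (_≡_; refl; sym; trans; cong; cong₂; subst)
open import Function.Bundles using (_↔_; Inverse; mk↔ₛ′)
open import Function.Properties.Inverse using (↔-trans)

module Encoding (V : Set) (R : CommutativeMonoid 0ℓ 0ℓ)
                (_⊗_ : Op₂ (CommutativeMonoid.Carrier R)) where

  open CommutativeMonoid R using (_≈_; _∙_; reflexive) renaming (Carrier to Rate)
  open Calculus V R _⊗_
  open Inverse using (to)

  Γe-subst : ∀ N X P → substO (Γe N) X (Γe P) ≡ Γe (substI N X P)
  Γe-subst N X nil         = refl
  Γe-subst N X (pre a l P) = cong (λ Q → del l (act a Q)) (Γe-subst N X P)
  Γe-subst N X (P +ᵢ Q)    = cong₂ _+ₒ_ (Γe-subst N X P) (Γe-subst N X Q)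
  Γe-subst N X (par P S Q) = cong₂ (λ P' Q' → par P' S Q') (Γe-subst N X P) (Γe-subst N X Q)
  Γe-subst N X (hide P H)  = cong (λ P' → hide P' H) (Γe-subst N X P)
  Γe-subst N X (ren P φ)   = cong (λ P' → ren P' φ) (Γe-subst N X P)
  Γe-subst N X (var Y) with Y ≟ X
  ... | yes _ = refl
  ... | no  _ = refl
  Γe-subst N X (rec Y P) with Y ≟ X
  ... | yes _ = refl
  ... | no  _ = cong (rec Y) (Γe-subst N X P)

  -- No term in the image of Γe has an action transition: every action prefix
  -- of Γe P is guarded by a delay, and the image is closed under unfolding.
  Γe-noAction : ∀ {Q a Q'} → OTAct Q a Q' → ∀ P → Q ≡ Γe P → ⊥
  Γe-noAction act nil         ()
  Γe-noAction act (pre _ _ _) ()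
  Γe-noAction act (_ +ᵢ _)    ()
  Γe-noAction act (par _ _ _) ()
  Γe-noAction act (hide _ _)  ()
  Γe-noAction act (ren _ _)   ()
  Γe-noAction act (var _)     ()
  Γe-noAction act (rec _ _)   ()
  Γe-noAction (sumL step)     (P +ᵢ Q)    refl = Γe-noAction step P refl
  Γe-noAction (sumR step)     (P +ᵢ Q)    refl = Γe-noAction step Q refl
  Γe-noAction (parL _ step)   (par P S Q) refl = Γe-noAction step P refl
  Γe-noAction (parR _ step)   (par P S Q) refl = Γe-noAction step Q refl
  Γe-noAction (sync _ step _) (par P S Q) refl = Γe-noAction step P refl
  Γe-noAction (hid step)      (hide P H)  refl = Γe-noAction step P refl
  Γe-noAction (rel step)      (ren P φ)   refl = Γe-noAction step P refl
  Γe-noAction (unf step)      (rec X P)   refl =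
    Γe-noAction step (substI (rec X P) X P) (Γe-subst (rec X P) X P)

  weaken : ∀ {Γ Δ P} → Γ ⊆ Δ → Scoped Γ P → Scoped Δ P
  weaken Γ⊆Δ nil       = nil
  weaken Γ⊆Δ (pre s)   = pre (weaken Γ⊆Δ s)
  weaken Γ⊆Δ (sum s t) = sum (weaken Γ⊆Δ s) (weaken Γ⊆Δ t)
  weaken Γ⊆Δ (par s t) = par (weaken Γ⊆Δ s) (weaken Γ⊆Δ t)
  weaken Γ⊆Δ (hide s)  = hide (weaken Γ⊆Δ s)
  weaken Γ⊆Δ (ren s)   = ren (weaken Γ⊆Δ s)
  weaken Γ⊆Δ (var X∈Γ) = var (Γ⊆Δ X∈Γ)
  weaken Γ⊆Δ (rec {X} s) = rec (weaken (∷⁺ʳ X Γ⊆Δ) s)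

  subst-scoped : ∀ {Γ N X P} → Closed N → Scoped (X ∷ Γ) P → Scoped Γ (substI N X P)
  subst-scoped cN nil       = nil
  subst-scoped cN (pre s)   = pre (subst-scoped cN s)
  subst-scoped cN (sum s t) = sum (subst-scoped cN s) (subst-scoped cN t)
  subst-scoped cN (par s t) = par (subst-scoped cN s) (subst-scoped cN t)
  subst-scoped cN (hide s)  = hide (subst-scoped cN s)
  subst-scoped cN (ren s)   = ren (subst-scoped cN s)
  subst-scoped {X = X} cN (var {Y} Y∈X∷Γ) with Y ≟ X | Y∈X∷Γ
  ... | yes _   | _         = weaken (λ ()) cN
  ... | no Y≢X  | here Y≡X  = ⊥-elim (Y≢X Y≡X)
  ... | no _    | there Y∈Γ = var Y∈Γ
  subst-scoped {X = X} cN (rec {Y} s) with Y ≟ X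
  ... | yes refl = rec (weaken contract s)
    where contract : ∀ {Γ} → Y ∷ Y ∷ Γ ⊆ Y ∷ Γ
          contract (here e)  = here e
          contract (there Z) = Z
  ... | no _ = rec (subst-scoped cN (weaken exchange s))
    where exchange : ∀ {Γ} → Y ∷ X ∷ Γ ⊆ X ∷ Y ∷ Γ
          exchange (here e)          = there (here e)
          exchange (there (here e))  = here e
          exchange (there (there Z)) = there (there Z)

  unbound⇒guardedIn : ∀ {Γ Y N} → Scoped Γ N → Y ∉ Γ → GuardedIn Y N
  unbound⇒guardedIn nil       Y∉Γ = nil
  unbound⇒guardedIn (pre s)   Y∉Γ = pre
  unbound⇒guardedIn (sum s t) Y∉Γ = sum (unbound⇒guardedIn s Y∉Γ) (unbound⇒guardedIn t Y∉Γ)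
  unbound⇒guardedIn (par s t) Y∉Γ = par (unbound⇒guardedIn s Y∉Γ) (unbound⇒guardedIn t Y∉Γ)
  unbound⇒guardedIn (hide s)  Y∉Γ = hide (unbound⇒guardedIn s Y∉Γ)
  unbound⇒guardedIn (ren s)   Y∉Γ = ren (unbound⇒guardedIn s Y∉Γ)
  unbound⇒guardedIn (var X∈Γ) Y∉Γ = var (λ { refl → Y∉Γ X∈Γ })
  unbound⇒guardedIn {Y = Y} (rec {Z} s) Y∉Γ with Z ≟ Y
  ... | yes refl = recEq
  ... | no Z≢Y   = recNe Z≢Y (unbound⇒guardedIn s λ { (here e) → Z≢Y (sym e) ; (there Y∈Γ) → Y∉Γ Y∈Γ })

  subst-guardedIn : ∀ {Y N X Q} → GuardedIn Y N → GuardedIn Y Q → GuardedIn Y (substI N X Q)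
  subst-guardedIn gN nil       = nil
  subst-guardedIn gN pre       = pre
  subst-guardedIn gN (sum g h) = sum (subst-guardedIn gN g) (subst-guardedIn gN h)
  subst-guardedIn gN (par g h) = par (subst-guardedIn gN g) (subst-guardedIn gN h)
  subst-guardedIn gN (hide g)  = hide (subst-guardedIn gN g)
  subst-guardedIn gN (ren g)   = ren (subst-guardedIn gN g)
  subst-guardedIn {X = X} gN (var {Z} Z≢Y) with Z ≟ X
  ... | yes _ = gN
  ... | no  _ = var Z≢Y
  subst-guardedIn {Y = Y} {X = X} gN recEq with Y ≟ X
  ... | yes _ = recEq
  ... | no  _ = recEq
  subst-guardedIn {X = X} gN (recNe {Z} Z≢Y g) with Z ≟ X
  ... | yes _ = recNe Z≢Y g
  ... | no  _ = recNe Z≢Y (subst-guardedIn gN g)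

  subst-guarded : ∀ {N X P} → Guarded N → (∀ Y → GuardedIn Y N) → Guarded P → Guarded (substI N X P)
  subst-guarded gN gN∀ nil       = nil
  subst-guarded gN gN∀ (pre g)   = pre (subst-guarded gN gN∀ g)
  subst-guarded gN gN∀ (sum g h) = sum (subst-guarded gN gN∀ g) (subst-guarded gN gN∀ h)
  subst-guarded gN gN∀ (par g h) = par (subst-guarded gN gN∀ g) (subst-guarded gN gN∀ h)
  subst-guarded gN gN∀ (hide g)  = hide (subst-guarded gN gN∀ g)
  subst-guarded gN gN∀ (ren g)   = ren (subst-guarded gN gN∀ g)
  subst-guarded {X = X} gN gN∀ (var {Y}) with Y ≟ X
  ... | yes _ = gN
  ... | no  _ = var
  subst-guarded {X = X} gN gN∀ (rec {Y} gY g) with Y ≟ X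
  ... | yes _ = rec gY g
  ... | no  _ = rec (subst-guardedIn (gN∀ Y) gY) (subst-guarded gN gN∀ g)

  subst-syncFree : ∀ {N X P} → SyncFree N → SyncFree P → SyncFree (substI N X P)
  subst-syncFree sN nil           = nil
  subst-syncFree sN (pre s)       = pre (subst-syncFree sN s)
  subst-syncFree sN (sum s t)     = sum (subst-syncFree sN s) (subst-syncFree sN t)
  subst-syncFree sN (par S∅ s t)  = par S∅ (subst-syncFree sN s) (subst-syncFree sN t)
  subst-syncFree sN (hide s)      = hide (subst-syncFree sN s)
  subst-syncFree sN (ren s)       = ren (subst-syncFree sN s)
  subst-syncFree {X = X} sN (var {Y}) with Y ≟ X
  ... | yes _ = sN
  ... | no  _ = var
  subst-syncFree {X = X} sN (rec {Y} s) with Y ≟ X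
  ... | yes _ = rec s
  ... | no  _ = rec (subst-syncFree sN s)

  -- The hypotheses of the theorem, which are invariant under unfolding.
  WellFormed : ITerm → Set
  WellFormed P = Closed P × Guarded P × SyncFree P

  unfold-wellFormed : ∀ {X P} → WellFormed (rec X P) → WellFormed (substI (rec X P) X P)
  unfold-wellFormed (rec s , rec gX g , rec sf) =
    subst-scoped (rec s) s ,
    subst-guarded (rec gX g) (λ Y → unbound⇒guardedIn (rec s) λ ()) g ,
    subst-syncFree (rec sf) sf

  -- Substituting for a
  -- guarded variable leaves it unchanged, so unfolding a guarded recursion
  -- decreases it by one: this is the measure of the main induction.
  size : ITerm → ℕ
  size nil         = 1
  size (pre _ _ _) = 1
  size (P +ᵢ Q)    = suc (size P + size Q)
  size (par P _ Q) = suc (size P + size Q)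
  size (hide P _)  = suc (size P)
  size (ren P _)   = suc (size P)
  size (var _)     = 1
  size (rec _ P)   = suc (size P)

  size-subst : ∀ {N X P} → GuardedIn X P → size (substI N X P) ≡ size P
  size-subst nil       = refl
  size-subst pre       = refl
  size-subst (sum g h) = cong₂ (λ m n → suc (m + n)) (size-subst g) (size-subst h)
  size-subst (par g h) = cong₂ (λ m n → suc (m + n)) (size-subst g) (size-subst h)
  size-subst (hide g)  = cong suc (size-subst g)
  size-subst (ren g)   = cong suc (size-subst g)
  size-subst {X = X} (var {Y} Y≢X) with Y ≟ X
  ... | yes Y≡X = ⊥-elim (Y≢X Y≡X)
  ... | no  _   = refl
  size-subst {X = X} recEq with X ≟ X
  ... | yes _   = refl
  ... | no  X≢X = ⊥-elim (X≢X refl)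
  size-subst {X = X} (recNe {Y} Y≢X g) with Y ≟ X
  ... | yes Y≡X = ⊥-elim (Y≢X Y≡X)
  ... | no  _   = cong suc (size-subst g)

  <-left : ∀ {m n k} → suc (m + n) < suc k → m < k
  <-left {m} lt = m+n≤o⇒m≤o (suc m) (s<s⁻¹ lt)

  <-right : ∀ {m n k} → suc (m + n) < suc k → n < k
  <-right {m} {n} lt = ≤-trans (s≤s (m≤n+m n m)) (s<s⁻¹ lt)

  Rated : Set₁
  Rated = Σ Set λ A → A → Rate

  _⊎ᵣ_ : Rated → Rated → Rated
  (A , ra) ⊎ᵣ (B , rb) = (A ⊎ B) , [ ra , rb ]′

  rates : ∀ {n} → (Fin n → Rate) → Rated
  rates {n} ρ = Fin n , ρ

  _++_ : ∀ {m n} → (Fin m → Rate) → (Fin n → Rate) → Fin (m + n) → Rate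
  _++_ {m} ρ σ i = [ ρ , σ ]′ (splitAt m i)

  record _≅_ (𝒜 ℬ : Rated) : Set where
    constructor mk≅
    field
      bijection     : proj₁ 𝒜 ↔ proj₁ ℬ
      preserve-rate : ∀ x → proj₂ ℬ (to bijection x) ≡ proj₂ 𝒜 x
  open _≅_ using (bijection)

  mk≅′ : ∀ {A ra B rb} (f : A → B) (g : B → A) → (∀ y → f (g y) ≡ y) → (∀ x → g (f x) ≡ x) →
         (∀ x → rb (f x) ≡ ra x) → (A , ra) ≅ (B , rb)
  mk≅′ f g f∘g g∘f f-rate = mk≅ (mk↔ₛ′ f g f∘g g∘f) f-rate

  ≅-trans : ∀ {𝒜 ℬ 𝒞} → 𝒜 ≅ ℬ → ℬ ≅ 𝒞 → 𝒜 ≅ 𝒞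
  ≅-trans (mk≅ f f-rate) (mk≅ g g-rate) =
    mk≅ (↔-trans f g) λ x → trans (g-rate (to f x)) (f-rate x)

  _⊎-≅_ : ∀ {𝒜 ℬ 𝒞 𝒟} → 𝒜 ≅ ℬ → 𝒞 ≅ 𝒟 → (𝒜 ⊎ᵣ 𝒞) ≅ (ℬ ⊎ᵣ 𝒟)
  mk≅ f f-rate ⊎-≅ mk≅ g g-rate = mk≅ (f ⊎-↔ g) λ { (inj₁ x) → f-rate x ; (inj₂ y) → g-rate y }

  ++-≅ : ∀ {m n} (ρ : Fin m → Rate) (σ : Fin n → Rate) → rates (ρ ++ σ) ≅ (rates ρ ⊎ᵣ rates σ)
  ++-≅ ρ σ = mk≅ +↔⊎ λ _ → refl

  CoEnumerated : Rated → Rated → Set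
  CoEnumerated 𝒜 ℬ = Σ ℕ λ n → Σ (Fin n → Rate) λ ρ → rates ρ ≅ 𝒜 × rates ρ ≅ ℬ

  coenum-≅ : ∀ {𝒜 ℬ 𝒜' ℬ'} → CoEnumerated 𝒜 ℬ → 𝒜 ≅ 𝒜' → ℬ ≅ ℬ' → CoEnumerated 𝒜' ℬ'
  coenum-≅ (n , ρ , e , f) g h = n , ρ , ≅-trans e g , ≅-trans f h

  coenum-⊎ : ∀ {𝒜 ℬ 𝒞 𝒟} → CoEnumerated 𝒜 ℬ → CoEnumerated 𝒞 𝒟 →
             CoEnumerated (𝒜 ⊎ᵣ 𝒞) (ℬ ⊎ᵣ 𝒟)
  coenum-⊎ (m , ρ , e , f) (n , σ , e' , f') =
    m + n , ρ ++ σ , ≅-trans (++-≅ ρ σ) (e ⊎-≅ e') , ≅-trans (++-≅ ρ σ) (f ⊎-≅ f')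

  coenum-empty : ∀ {A ra B rb} → ¬ A → ¬ B → CoEnumerated (A , ra) (B , rb)
  coenum-empty ¬A ¬B = 0 , (λ ()) , empty ¬A , empty ¬B
    where empty : ∀ {A r} → ¬ A → rates {0} (λ ()) ≅ (A , r)
          empty ¬A = mk≅′ (λ ()) (λ x → ⊥-elim (¬A x)) (λ x → ⊥-elim (¬A x)) (λ ()) (λ ())

  coenum-singleton : ∀ {A ra B rb} (x : A) (y : B) → (∀ x' → x ≡ x') → (∀ y' → y ≡ y') →
                     rb y ≡ ra x → CoEnumerated (A , ra) (B , rb)
  coenum-singleton {ra = ra} x y x-unique y-unique rates-equal =
    1 , (λ _ → ra x) , single x x-unique refl , single y y-unique rates-equal
    where single : ∀ {A r l} (x : A) → (∀ x' → x ≡ x') → r x ≡ l → rates {1} (λ _ → l) ≅ (A , r)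
          single x unique rate = mk≅′ (λ _ → x) (λ _ → zero) unique (λ { zero → refl }) (λ _ → rate)

  sumFin-cong : ∀ n {f g : Fin n → Rate} → (∀ i → f i ≡ g i) → sumFin n f ≡ sumFin n g
  sumFin-cong zero    f≡g = refl
  sumFin-cong (suc n) f≡g = cong₂ _∙_ (f≡g zero) (sumFin-cong n (λ i → f≡g (suc i)))

  enumeration-total : ∀ {n} {ρ : Fin n → Rate} {A r} (e : rates ρ ≅ (A , r)) →
                      sumFin n ρ ≈ sumFin n (λ i → r (to (bijection e) i))
  enumeration-total {n} (mk≅ _ e-rate) = reflexive (sumFin-cong n λ i → sym (e-rate i))

  ITD : ITerm → Rated
  ITD P = ITDer P , itRate

  OTD : OTerm → Rated
  OTD Q = OTDer Q , otRate

  coenumerated⇒sameRate : ∀ {P Q} → CoEnumerated (ITD P) (OTD Q) →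
                          Σ Rate λ r → RateIT P r × RateOT Q r
  coenumerated⇒sameRate (n , ρ , e , f) =
    sumFin n ρ , (n , bijection e , enumeration-total e) , (n , bijection f , enumeration-total f)

  nil-coenumerated : CoEnumerated (ITD nil) (OTD (Γe nil))
  nil-coenumerated = coenum-empty (λ { (_ , _ , _ , ()) }) (λ { (_ , _ , ()) })

  var-coenumerated : ∀ {X} → CoEnumerated (ITD (var X)) (OTD (Γe (var X)))
  var-coenumerated = coenum-empty (λ { (_ , _ , _ , ()) }) (λ { (_ , _ , ()) })

  pre-coenumerated : ∀ {a l P} → CoEnumerated (ITD (pre a l P)) (OTD (Γe (pre a l P)))
  pre-coenumerated {a} {l} {P} =
    coenum-singleton (a , l , P , pre) (l , act a (Γe P) , del)
                     (λ { (_ , _ , _ , pre) → refl }) (λ { (_ , _ , del) → refl }) refl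

  sum-ITD : ∀ {P Q} → (ITD P ⊎ᵣ ITD Q) ≅ ITD (P +ᵢ Q)
  sum-ITD {P} {Q} = mk≅′ inject project inject∘project project∘inject
                        λ { (inj₁ _) → refl ; (inj₂ _) → refl }
    where
    inject : ITDer P ⊎ ITDer Q → ITDer (P +ᵢ Q)
    inject (inj₁ (a , l , P' , d)) = a , l , P' , sumL d
    inject (inj₂ (a , l , Q' , d)) = a , l , Q' , sumR d
    project : ITDer (P +ᵢ Q) → ITDer P ⊎ ITDer Q
    project (a , l , P' , sumL d) = inj₁ (a , l , P' , d)
    project (a , l , Q' , sumR d) = inj₂ (a , l , Q' , d)
    inject∘project : ∀ x → inject (project x) ≡ x
    inject∘project (_ , _ , _ , sumL _) = refl
    inject∘project (_ , _ , _ , sumR _) = refl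
    project∘inject : ∀ x → project (inject x) ≡ x
    project∘inject (inj₁ _) = refl
    project∘inject (inj₂ _) = refl

  sum-OTD : ∀ {P Q} → (OTD P ⊎ᵣ OTD Q) ≅ OTD (P +ₒ Q)
  sum-OTD {P} {Q} = mk≅′ inject project inject∘project project∘inject
                        λ { (inj₁ _) → refl ; (inj₂ _) → refl }
    where
    inject : OTDer P ⊎ OTDer Q → OTDer (P +ₒ Q)
    inject (inj₁ (l , P' , d)) = l , P' , sumL d
    inject (inj₂ (l , Q' , d)) = l , Q' , sumR d
    project : OTDer (P +ₒ Q) → OTDer P ⊎ OTDer Q
    project (l , P' , sumL d) = inj₁ (l , P' , d)
    project (l , Q' , sumR d) = inj₂ (l , Q' , d)
    inject∘project : ∀ x → inject (project x) ≡ x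
    inject∘project (_ , _ , sumL _) = refl
    inject∘project (_ , _ , sumR _) = refl
    project∘inject : ∀ x → project (inject x) ≡ x
    project∘inject (inj₁ _) = refl
    project∘inject (inj₂ _) = refl

  notIn-empty : ∀ {S} → Empty S → ∀ a → NotIn S a
  notIn-empty S∅ τ       = τ∉
  notIn-empty S∅ (vis v) = v∉ (S∅ v)

  notIn-irrelevant : ∀ {S a} (p q : NotIn S a) → p ≡ q
  notIn-irrelevant τ∉     τ∉     = refl
  notIn-irrelevant (v∉ p) (v∉ q) = cong v∉ (Decidable⇒UIP.≡-irrelevant _≟ᵇ_ p q)

  no-sync : ∀ {S v} → Empty S → S v ≡ true → ⊥
  no-sync {v = v} S∅ Sv with trans (sym Sv) (S∅ v)
  ... | ()

  par-ITD : ∀ {P S Q} → Empty S → (ITD P ⊎ᵣ ITD Q) ≅ ITD (par P S Q)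
  par-ITD {P} {S} {Q} S∅ = mk≅′ inject project inject∘project project∘inject
                               λ { (inj₁ _) → refl ; (inj₂ _) → refl }
    where
    inject : ITDer P ⊎ ITDer Q → ITDer (par P S Q)
    inject (inj₁ (a , l , P' , d)) = a , l , par P' S Q , parL (notIn-empty S∅ a) d
    inject (inj₂ (a , l , Q' , d)) = a , l , par P S Q' , parR (notIn-empty S∅ a) d
    project : ITDer (par P S Q) → ITDer P ⊎ ITDer Q
    project (a , l , _ , parL {P' = P'} _ d) = inj₁ (a , l , P' , d)
    project (a , l , _ , parR {Q' = Q'} _ d) = inj₂ (a , l , Q' , d)
    project (_ , _ , _ , sync Sv _ _)        = ⊥-elim (no-sync S∅ Sv)
    inject∘project : ∀ x → inject (project x) ≡ x
    inject∘project (a , l , _ , parL a∉S d) = cong (λ a∉S′ → a , l , _ , parL a∉S′ d) (notIn-irrelevant _ a∉S)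
    inject∘project (a , l , _ , parR a∉S d) = cong (λ a∉S′ → a , l , _ , parR a∉S′ d) (notIn-irrelevant _ a∉S)
    inject∘project (_ , _ , _ , sync Sv _ _) = ⊥-elim (no-sync S∅ Sv)
    project∘inject : ∀ x → project (inject x) ≡ x
    project∘inject (inj₁ _) = refl
    project∘inject (inj₂ _) = refl

  par-OTD : ∀ {P S Q} → (OTD P ⊎ᵣ OTD Q) ≅ OTD (par P S Q)
  par-OTD {P} {S} {Q} = mk≅′ inject project inject∘project project∘inject
                            λ { (inj₁ _) → refl ; (inj₂ _) → refl }
    where
    inject : OTDer P ⊎ OTDer Q → OTDer (par P S Q)
    inject (inj₁ (l , P' , d)) = l , par P' S Q , parL d
    inject (inj₂ (l , Q' , d)) = l , par P S Q' , parR d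
    project : OTDer (par P S Q) → OTDer P ⊎ OTDer Q
    project (l , _ , parL {P' = P'} d) = inj₁ (l , P' , d)
    project (l , _ , parR {Q' = Q'} d) = inj₂ (l , Q' , d)
    inject∘project : ∀ x → inject (project x) ≡ x
    inject∘project (_ , _ , parL _) = refl
    inject∘project (_ , _ , parR _) = refl
    project∘inject : ∀ x → project (inject x) ≡ x
    project∘inject (inj₁ _) = refl
    project∘inject (inj₂ _) = refl

  hide-ITD : ∀ {P H} → ITD P ≅ ITD (hide P H)
  hide-ITD {H = H} =
    mk≅′ (λ { (a , l , P' , d) → hideN H a , l , hide P' H , hid d })
         (λ { (_ , l , _ , hid d) → _ , l , _ , d })
         (λ { (_ , _ , _ , hid _) → refl }) (λ _ → refl) (λ _ → refl)

  hide-OTD : ∀ {P H} → OTD P ≅ OTD (hide P H)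
  hide-OTD {H = H} =
    mk≅′ (λ { (l , P' , d) → l , hide P' H , hid d })
         (λ { (l , _ , hid d) → l , _ , d })
         (λ { (_ , _ , hid _) → refl }) (λ _ → refl) (λ _ → refl)

  ren-ITD : ∀ {P φ} → ITD P ≅ ITD (ren P φ)
  ren-ITD {φ = φ} =
    mk≅′ (λ { (a , l , P' , d) → relab φ a , l , ren P' φ , rel d })
         (λ { (_ , l , _ , rel d) → _ , l , _ , d })
         (λ { (_ , _ , _ , rel _) → refl }) (λ _ → refl) (λ _ → refl)

  ren-OTD : ∀ {P φ} → OTD P ≅ OTD (ren P φ)
  ren-OTD {φ = φ} =
    mk≅′ (λ { (l , P' , d) → l , ren P' φ , rel d })
         (λ { (l , _ , rel d) → l , _ , d })
         (λ { (_ , _ , rel _) → refl }) (λ _ → refl) (λ _ → refl)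

  -- A recursion moves exactly as its unfolding.  On the OTMPC side the
  -- unfolding is given up to an equation, to be supplied by Γe-subst.
  rec-ITD : ∀ {X P} → ITD (substI (rec X P) X P) ≅ ITD (rec X P)
  rec-ITD =
    mk≅′ (λ { (a , l , P' , d) → a , l , P' , unf d })
         (λ { (a , l , P' , unf d) → a , l , P' , d })
         (λ { (_ , _ , _ , unf _) → refl }) (λ _ → refl) (λ _ → refl)

  rec-OTD : ∀ {X Q Q₀} → substO (rec X Q) X Q ≡ Q₀ → OTD Q₀ ≅ OTD (rec X Q)
  rec-OTD refl =
    mk≅′ (λ { (l , Q' , d) → l , Q' , unf d })
         (λ { (l , Q' , unf d) → l , Q' , d })
         (λ { (_ , _ , unf _) → refl }) (λ _ → refl) (λ _ → refl)

  -- Each operator is handled by its decomposition lemmas; recursion is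
  -- replaced by its unfolding, which is well formed and smaller.
  coenumerated-below : (k : ℕ) → ∀ P → size P < k → WellFormed P → CoEnumerated (ITD P) (OTD (Γe P))
  coenumerated-below zero    P           () _
  coenumerated-below (suc k) nil         _  _ = nil-coenumerated
  coenumerated-below (suc k) (pre a l P) _  _ = pre-coenumerated
  coenumerated-below (suc k) (var X)     _  _ = var-coenumerated
  coenumerated-below (suc k) (P +ᵢ Q) lt (sum cP cQ , sum gP gQ , sum sP sQ) =
    coenum-≅ (coenum-⊎ (coenumerated-below k P (<-left lt) (cP , gP , sP))
                       (coenumerated-below k Q (<-right lt) (cQ , gQ , sQ)))
             sum-ITD sum-OTD
  coenumerated-below (suc k) (par P S Q) lt (par cP cQ , par gP gQ , par S∅ sP sQ) =
    coenum-≅ (coenum-⊎ (coenumerated-below k P (<-left lt) (cP , gP , sP))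
                       (coenumerated-below k Q (<-right lt) (cQ , gQ , sQ)))
             (par-ITD S∅) par-OTD
  coenumerated-below (suc k) (hide P H) lt (hide c , hide g , hide s) =
    coenum-≅ (coenumerated-below k P (s<s⁻¹ lt) (c , g , s)) hide-ITD hide-OTD
  coenumerated-below (suc k) (ren P φ) lt (ren c , ren g , ren s) =
    coenum-≅ (coenumerated-below k P (s<s⁻¹ lt) (c , g , s)) ren-ITD ren-OTD
  coenumerated-below (suc k) (rec X P) lt wf@(_ , rec gX _ , _) =
    coenum-≅ (coenumerated-below k (substI (rec X P) X P) unfolding-smaller (unfold-wellFormed wf))
             rec-ITD (rec-OTD (Γe-subst (rec X P) X P))
    where unfolding-smaller : size (substI (rec X P) X P) < k
          unfolding-smaller = subst (_< k) (sym (size-subst gX)) (s<s⁻¹ lt)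

  coenumerated : ∀ P → WellFormed P → CoEnumerated (ITD P) (OTD (Γe P))
  coenumerated P = coenumerated-below (suc (size P)) P ≤-refl

lemma5 : (V : Set) (R : CommutativeMonoid 0ℓ 0ℓ)
    (_⊗_ : Op₂ (CommutativeMonoid.Carrier R)) →
    IsCommutativeSemigroup (CommutativeMonoid._≈_ R) _⊗_ →
    let open Calculus V R _⊗_ in
    (P : ITerm) → Closed P → Guarded P → SyncFree P →
    ((a : Name) (Q' : OTerm) → ¬ OTAct (Γe P) a Q')
    × Σ (CommutativeMonoid.Carrier R) (λ r → RateIT P r × RateOT (Γe P) r)
lemma5 V R _⊗_ _ P closed guarded syncFree =
  (λ a Q' step → Γe-noAction step P refl) ,
  coenumerated⇒sameRate (coenumerated P (closed , guarded , syncFree))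
  where open Encoding V R _⊗_
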